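{- For a positive integer $s$, let $f(s)$ be the number of positive integers $n$ for which there exists a positive integer $p$ such that the triple $(s,p,n)$ is admissible. Then $f(s)=0$ for $1\leq s\leq 11$, $f(s)=s-10$ for all $s\geq 19$, and $(f(12),f(13),f(14),f(15),f(16),f(17),f(18))=(1,2,4,4,6,7,7)$.
   Context: An $n$-partition of a positive integer $s$ is a multiset $\{x_1,\dots,x_n\}$ of $n$ positive integers with $x_1+\cdots+x_n=s$. For such a multiset define $T\{x_1,\dots,x_n\}=(s,p,n)$ where $s=x_1+\cdots+x_n$ and $p=x_1x_2\cdots x_n$. An ordered triple $(s,p,n)$ of positive integers is called admissible if there exist at least two different multisets $X$, $Y$ of $n$ positive integers with $T(X)=T(Y)=(s,p,n)$, i.e. sharing the same sum $s$, the same product $p$ and the same size $n$. -}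

module Defs where

open import Data.Nat using (ℕ; _>_; _≤_)
open import Data.List using (List; length)
open import Data.Nat.ListAction using (sum; product)
open import Relation.Binary.PropositionalEquality using (_≡_)
open import Data.List.Relation.Unary.All using (All)
open import Data.List.Relation.Binary.Permutation.Propositional using (_↭_)
open import Data.List.Relation.Unary.Unique.Propositional using (Unique)
open import Data.List.Membership.Propositional using (_∈_)
open import Data.Product using (Σ; ∃; _×_)
open import Function.Bundles using (_⇔_)
open import Relation.Nullary using (¬_)

-- A multiset of positive integers is represented by a list, two lists
-- representing the same multiset iff they are permutations of each other.

HasT : List ℕ → ℕ → ℕ → ℕ → Set
HasT X s p n = All (λ x → x > 0) X × sum X ≡ s × product X ≡ p × length X ≡ n

Admissible : ℕ → ℕ → ℕ → Set
Admissible s p n =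
  Σ (List ℕ) λ X → Σ (List ℕ) λ Y → HasT X s p n × HasT Y s p n × ¬ (X ↭ Y)

AdmissibleSize : ℕ → ℕ → Set
AdmissibleSize s n = n > 0 × ∃ λ p → p > 0 × Admissible s p n

HasCount : (ℕ → Set) → ℕ → Set
HasCount P k = Σ (List ℕ) λ L → Unique L × (∀ n → (n ∈ L) ⇔ P n) × length L ≡ k

fIs : ℕ → ℕ → Set
fIs s k = HasCount (AdmissibleSize s) k

module Submission where

-- Write s = n + e. Subtracting 1 from every part turns an n-partition of s into its ones together
-- with a composition R of the excess e into at most n positive parts, and the product into
-- ∏ (1 + r). So (s, p, n) is admissible exactly when two different such R, of at most n parts,
-- have the same ∏ (1 + r). For n = 1, 2 sum and product determine the parts; for e ≤ 7, and for
-- the five exceptional pairs (e, n), an exhaustive comparison of compositions rules collisions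
-- out. In all other cases with n ≥ 3 and e ≥ 8 an explicit collision with at most n parts,
-- padded with ones, is admissible: a table covers e < 53 and a two-parameter family of triples
-- all larger e.

open import Data.Nat using (ℕ; zero; suc; _+_; _*_; _∸_; _⊓_; _≤_; _<_; _≟_; _≤?_; _<?_; s≤s; z≤n; z<s)
open import Data.Nat.ListAction using (sum; product)
open import Data.Nat.Properties
open import Data.Nat.Tactic.RingSolver using (solve-∀)
open import Data.Empty using (⊥-elim)
open import Data.List using (List; []; _∷_; _++_; [_]; map; concatMap; length; replicate; filter; applyUpTo; upTo)
open import Data.List.Membership.Propositional using (_∈_; _∉_; find; lose)
open import Data.List.Membership.Propositional.Properties
  using (∈-concatMap⁺; ∈-map⁺; ∈-upTo⁺; ∈-applyUpTo⁺; ∈-applyUpTo⁻; ∈-filter⁺; ∈-filter⁻)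
import Data.List.Membership.DecPropositional as DecMembership
import Data.List.Properties as List
open import Data.List.Relation.Binary.Permutation.Propositional
  using (_↭_; ↭-refl; ↭-sym; ↭-trans; ↭-reflexive; prep; swap; module PermutationReasoning)
open import Data.List.Relation.Binary.Permutation.Propositional.Properties
  using (++⁺ˡ; map⁺; shift; drop-∷; ↭-length; ∈-resp-↭)
open import Data.List.Relation.Unary.All as All using (All; []; _∷_)
open import Data.List.Relation.Unary.All.Properties using (All¬⇒¬Any)
open import Data.List.Relation.Unary.Any as Any using (Any; here; there)
open import Data.List.Relation.Unary.Unique.Propositional.Properties using (filter⁺; upTo⁺; applyUpTo⁺₁)
open import Data.List.Sort.InsertionSort.Base ≤-decTotalOrder using (sort)
open import Data.List.Sort.InsertionSort.Properties ≤-decTotalOrder using (sort-↭)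
import Data.Product.Properties as Product
open import Data.Product using (_×_; ∃; _,_; proj₁; proj₂; uncurry)
open import Data.Sum using (_⊎_; inj₁; inj₂)
open import Function using (_∘_; _⇔_; mk⇔; Equivalence)
open import Function.Construct.Composition using (_⇔-∘_)
open import Function.Construct.Symmetry using (⇔-sym)
open import Relation.Binary.PropositionalEquality using (_≡_; refl; sym; trans; cong; subst; subst₂; module ≡-Reasoning)
open import Relation.Nullary using (Dec; yes; no; ¬_)
open import Relation.Nullary.Decidable using (from-yes; _×-dec_; _⊎-dec_; _→-dec_; ¬?)
open import Relation.Unary using (Decidable)

open import Defs

private
  variable
    s p n e k : ℕ
    X Y : List ℕ

∈-concatMap-intro : ∀ {A B : Set} (f : A → List B) {x xs y} → x ∈ xs → y ∈ f x → y ∈ concatMap f xs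
∈-concatMap-intro f x∈xs y∈fx = ∈-concatMap⁺ f (lose x∈xs y∈fx)

∈-applyUpTo-+⇔ : ∀ a l → n ∈ applyUpTo (a +_) l ⇔ (a ≤ n × n < a + l)
∈-applyUpTo-+⇔ {n} a l = mk⇔ to from
  where
  to : n ∈ applyUpTo (a +_) l → a ≤ n × n < a + l
  to n∈ with i , i<l , refl ← ∈-applyUpTo⁻ (a +_) n∈ = m≤m+n a i , +-monoʳ-< a i<l
  from : a ≤ n × n < a + l → n ∈ applyUpTo (a +_) l
  from (a≤n , n<a+l) = subst (_∈ applyUpTo (a +_) l) (m+[n∸m]≡n a≤n)
    (∈-applyUpTo⁺ (a +_) (+-cancelˡ-< a _ _ (subst (_< a + l) (sym (m+[n∸m]≡n a≤n)) n<a+l)))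

Positive : List ℕ → Set
Positive = All (0 <_)

product-positive : Positive X → 0 < product X
product-positive [] = s≤s z≤n
product-positive {suc x ∷ xs} (_ ∷ pos) = ≤-trans (product-positive pos) (m≤m+n (product xs) (x * product xs))

length≤sum : Positive X → length X ≤ sum X
length≤sum [] = z≤n
length≤sum {suc x ∷ xs} (_ ∷ pos) = s≤s (≤-trans (length≤sum pos) (m≤n+m (sum xs) x))

reduced : List ℕ → List ℕ
reduced []                 = []
reduced (zero ∷ xs)        = reduced xs
reduced (suc zero ∷ xs)    = reduced xs
reduced (suc (suc x) ∷ xs) = suc x ∷ reduced xs

ones : List ℕ → ℕ
ones []                 = 0
ones (zero ∷ xs)        = ones xs
ones (suc zero ∷ xs)    = suc (ones xs)
ones (suc (suc x) ∷ xs) = ones xs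

reduced-positive : ∀ X → Positive (reduced X)
reduced-positive []                 = []
reduced-positive (zero ∷ xs)        = reduced-positive xs
reduced-positive (suc zero ∷ xs)    = reduced-positive xs
reduced-positive (suc (suc x) ∷ xs) = z<s ∷ reduced-positive xs

↭-ones++reduced : Positive X → X ↭ replicate (ones X) 1 ++ map suc (reduced X)
↭-ones++reduced [] = ↭-refl
↭-ones++reduced {suc zero ∷ xs} (_ ∷ pos) = prep 1 (↭-ones++reduced pos)
↭-ones++reduced {suc (suc x) ∷ xs} (_ ∷ pos) =
  ↭-trans (prep (2 + x) (↭-ones++reduced pos)) (↭-sym (shift (2 + x) (replicate (ones xs) 1) (map suc (reduced xs))))

sum-reduced : Positive X → sum X ≡ length X + sum (reduced X)
sum-reduced [] = refl
sum-reduced {suc zero ∷ xs} (_ ∷ pos) = cong suc (sum-reduced pos)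
sum-reduced {suc (suc x) ∷ xs} (_ ∷ pos) = begin
  2 + x + sum xs                               ≡⟨ cong (2 + x +_) (sum-reduced pos) ⟩
  2 + x + (length xs + sum (reduced xs))       ≡⟨ shuffle x (length xs) (sum (reduced xs)) ⟩
  suc (length xs) + (suc x + sum (reduced xs)) ∎
  where
  open ≡-Reasoning
  shuffle : ∀ x l r → 2 + x + (l + r) ≡ suc l + (suc x + r)
  shuffle = solve-∀

product-reduced : Positive X → product X ≡ product (map suc (reduced X))
product-reduced [] = refl
product-reduced {suc zero ∷ xs} (_ ∷ pos) = trans (+-identityʳ (product xs)) (product-reduced pos)
product-reduced {suc (suc x) ∷ xs} (_ ∷ pos) = cong ((2 + x) *_) (product-reduced pos)

length-reduced : Positive X → length X ≡ ones X + length (reduced X)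
length-reduced [] = refl
length-reduced {suc zero ∷ xs} (_ ∷ pos) = cong suc (length-reduced pos)
length-reduced {suc (suc x) ∷ xs} (_ ∷ pos) = trans (cong suc (length-reduced pos)) (sym (+-suc (ones xs) _))

ones-cong : Positive X → Positive Y → length X ≡ length Y → length (reduced X) ≡ length (reduced Y) → ones X ≡ ones Y
ones-cong {X} {Y} posX posY lX≡lY rX≡rY = +-cancelʳ-≡ (length (reduced X)) (ones X) (ones Y) (begin
  ones X + length (reduced X) ≡⟨ sym (length-reduced posX) ⟩
  length X                    ≡⟨ lX≡lY ⟩
  length Y                    ≡⟨ length-reduced posY ⟩
  ones Y + length (reduced Y) ≡⟨ cong (ones Y +_) (sym rX≡rY) ⟩
  ones Y + length (reduced X) ∎)
  where open ≡-Reasoning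

↭-of-reduced : Positive X → Positive Y → length X ≡ length Y → reduced X ↭ reduced Y → X ↭ Y
↭-of-reduced {X} {Y} posX posY lX≡lY rX↭rY = begin
  X                                           ↭⟨ ↭-ones++reduced posX ⟩
  replicate (ones X) 1 ++ map suc (reduced X) ≡⟨ cong (λ o → replicate o 1 ++ map suc (reduced X)) ones≡ ⟩
  replicate (ones Y) 1 ++ map suc (reduced X) ↭⟨ ++⁺ˡ (replicate (ones Y) 1) (map⁺ suc rX↭rY) ⟩
  replicate (ones Y) 1 ++ map suc (reduced Y) ↭⟨ ↭-ones++reduced posY ⟨
  Y                                           ∎
  where
  open PermutationReasoning
  ones≡ : ones X ≡ ones Y
  ones≡ = ones-cong posX posY lX≡lY (↭-length rX↭rY)

compositions : ℕ → ℕ → List (List ℕ)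
compositions zero    zero    = [] ∷ []
compositions (suc s) zero    = []
compositions s       (suc n) = concatMap (λ a → map (suc a ∷_) (compositions (s ∸ suc a) n)) (upTo s)

∈-compositions : Positive X → X ∈ compositions (sum X) (length X)
∈-compositions [] = here refl
∈-compositions {suc x ∷ xs} (_ ∷ pos) =
  ∈-concatMap-intro _ (∈-upTo⁺ (s≤s (m≤m+n x (sum xs))))
    (∈-map⁺ (suc x ∷_) (subst (λ s → xs ∈ compositions s (length xs)) (sym (m+n∸m≡n (suc x) (sum xs))) (∈-compositions pos)))

compositionsUpTo : ℕ → ℕ → List (List ℕ)
compositionsUpTo s k = concatMap (compositions s) (upTo (suc k))

∈-compositionsUpTo : Positive X → length X ≤ k → X ∈ compositionsUpTo (sum X) k
∈-compositionsUpTo pos l≤k = ∈-concatMap-intro _ (∈-upTo⁺ (s≤s l≤k)) (∈-compositions pos)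

Rigid : ℕ → ℕ → Set
Rigid e k = All (λ A → All (λ B → product (map suc A) ≡ product (map suc B) → sort A ≡ sort B) C) C
  where C = compositionsUpTo e k

rigid? : ∀ e k → Dec (Rigid e k)
rigid? e k = All.all? (λ A → All.all? (λ B → product (map suc A) ≟ product (map suc B) →-dec List.≡-dec _≟_ (sort A) (sort B)) C) C
  where C = compositionsUpTo e k

rigid⇒↭ : ∀ {A B} → Rigid e k → A ∈ compositionsUpTo e k → B ∈ compositionsUpTo e k →
          product (map suc A) ≡ product (map suc B) → A ↭ B
rigid⇒↭ {A = A} {B} rigid A∈ B∈ products≡ = begin
  A      ↭⟨ sort-↭ A ⟨
  sort A ≡⟨ All.lookup (All.lookup rigid A∈) B∈ products≡ ⟩
  sort B ↭⟨ sort-↭ B ⟩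
  B      ∎
  where open PermutationReasoning

reduced-excess : HasT X (n + e) p n → sum (reduced X) ≡ e
reduced-excess {X} {n} {e} (pos , sX , _ , lX) = +-cancelˡ-≡ n (sum (reduced X)) e (begin
  n + sum (reduced X)        ≡⟨ cong (_+ sum (reduced X)) lX ⟨
  length X + sum (reduced X) ≡⟨ sum-reduced pos ⟨
  sum X                      ≡⟨ sX ⟩
  n + e                      ∎)
  where open ≡-Reasoning

reduced-length : HasT X (n + e) p n → length (reduced X) ≤ n ⊓ e
reduced-length {X} {n} {e} h@(pos , _ , _ , lX) = ⊓-glb ≤n ≤e
  where
  ≤n : length (reduced X) ≤ n
  ≤n = subst (length (reduced X) ≤_) (trans (sym (length-reduced pos)) lX) (m≤n+m _ (ones X))
  ≤e : length (reduced X) ≤ e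
  ≤e = subst (length (reduced X) ≤_) (reduced-excess h) (length≤sum (reduced-positive X))

reduced-∈ : HasT X (n + e) p n → n ⊓ e ≤ k → reduced X ∈ compositionsUpTo e k
reduced-∈ {X} {k = k} h n⊓e≤k = subst (λ e → reduced X ∈ compositionsUpTo e k) (reduced-excess h)
  (∈-compositionsUpTo (reduced-positive X) (≤-trans (reduced-length h) n⊓e≤k))

rigid⇒¬admissible : Rigid e k → n ⊓ e ≤ k → ¬ Admissible (n + e) p n
rigid⇒¬admissible {e} {k} rigid n⊓e≤k (X , Y , hX@(posX , _ , pX , lX) , hY@(posY , _ , pY , lY) , X≁Y) =
  X≁Y (↭-of-reduced posX posY (trans lX (sym lY))
    (rigid⇒↭ {e} {k} rigid (reduced-∈ {e = e} hX n⊓e≤k) (reduced-∈ {e = e} hY n⊓e≤k) products≡))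
  where
  products≡ : product (map suc (reduced X)) ≡ product (map suc (reduced Y))
  products≡ = trans (sym (product-reduced posX)) (trans pX (trans (sym pY) (product-reduced posY)))

hasT-singleton : HasT X s p 1 → X ≡ [ s ]
hasT-singleton {[]}          (_ , _ , _ , ())
hasT-singleton {x ∷ []}      (_ , refl , _) = cong [_] (sym (+-identityʳ x))
hasT-singleton {_ ∷ _ ∷ _}   (_ , _ , _ , ())

¬admissible-1 : ¬ Admissible s p 1
¬admissible-1 (_ , _ , hX , hY , X≁Y) = X≁Y (↭-reflexive (trans (hasT-singleton hX) (sym (hasT-singleton hY))))

hasT-pair : HasT X s p 2 → ∃ λ a → ∃ λ b → X ≡ a ∷ b ∷ [] × a + b ≡ s × a * b ≡ p
hasT-pair {[]}            (_ , _ , _ , ())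
hasT-pair {_ ∷ []}        (_ , _ , _ , ())
hasT-pair {a ∷ b ∷ []}    (_ , refl , refl , _) = a , b , refl , cong (a +_) (sym (+-identityʳ b)) , cong (a *_) (sym (*-identityʳ b))
hasT-pair {_ ∷ _ ∷ _ ∷ _} (_ , _ , _ , ())

cross-cancel : ∀ a x d → a * (x + d) ≡ (a + x) * d → x ≡ 0 ⊎ a ≡ d
cross-cancel a zero    d _  = inj₁ refl
cross-cancel a (suc y) d eq = inj₂ (*-cancelʳ-≡ a d (suc y) (+-cancelʳ-≡ (a * d) _ _ (begin
  a * suc y + a * d ≡⟨ *-distribˡ-+ a (suc y) d ⟨
  a * (suc y + d)   ≡⟨ eq ⟩
  (a + suc y) * d   ≡⟨ *-distribʳ-+ d a (suc y) ⟩
  a * d + suc y * d ≡⟨ +-comm (a * d) (suc y * d) ⟩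
  suc y * d + a * d ≡⟨ cong (_+ a * d) (*-comm (suc y) d) ⟩
  d * suc y + a * d ∎)))
  where open ≡-Reasoning

pair-↭-+ : ∀ {a b d} x → a + b ≡ a + x + d → a * b ≡ (a + x) * d → a ∷ b ∷ [] ↭ a + x ∷ d ∷ []
pair-↭-+ {a} {b} {d} x sums≡ products≡
  with refl ← +-cancelˡ-≡ a b (x + d) (trans sums≡ (+-assoc a x d))
  with cross-cancel a x d products≡
... | inj₁ refl = ↭-reflexive (cong (_∷ [ d ]) (sym (+-identityʳ a)))
... | inj₂ refl = ↭-trans (swap a (x + a) ↭-refl) (↭-reflexive (cong (_∷ [ a ]) (+-comm x a)))

pair-↭-≤ : ∀ {a b c d} → a ≤ c → a + b ≡ c + d → a * b ≡ c * d → a ∷ b ∷ [] ↭ c ∷ d ∷ []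
pair-↭-≤ {a} {c = c} a≤c with c ∸ a | m+[n∸m]≡n a≤c
... | x | refl = pair-↭-+ x

pair-↭ : ∀ {a b c d} → a + b ≡ c + d → a * b ≡ c * d → a ∷ b ∷ [] ↭ c ∷ d ∷ []
pair-↭ {a} {_} {c} sums≡ products≡ with ≤-total a c
... | inj₁ a≤c = pair-↭-≤ a≤c sums≡ products≡
... | inj₂ c≤a = ↭-sym (pair-↭-≤ c≤a (sym sums≡) (sym products≡))

¬admissible-2 : ¬ Admissible s p 2
¬admissible-2 (_ , _ , hX , hY , X≁Y)
  with a , b , refl , ab-sum , ab-product ← hasT-pair hX
     | c , d , refl , cd-sum , cd-product ← hasT-pair hY
  = X≁Y (pair-↭ (trans ab-sum (sym cd-sum)) (trans ab-product (sym cd-product)))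

admissible⇒3≤ : 0 < n → Admissible s p n → 3 ≤ n
admissible⇒3≤ {1} _ adm = ⊥-elim (¬admissible-1 adm)
admissible⇒3≤ {2} _ adm = ⊥-elim (¬admissible-2 adm)
admissible⇒3≤ {suc (suc (suc _))} _ _ = s≤s (s≤s (s≤s z≤n))

exceptions : List (ℕ × ℕ)
exceptions = (8 , 3) ∷ (9 , 3) ∷ (9 , 4) ∷ (12 , 3) ∷ (15 , 3) ∷ []

_∈exceptions? : ∀ en → Dec (en ∈ exceptions)
en ∈exceptions? = en ∈? exceptions
  where open DecMembership (Product.≡-dec _≟_ _≟_)

exception-bounds : (e , n) ∈ exceptions → n ≤ 4 × e + n ≤ 18
exception-bounds = All.lookup bounds
  where
  bounds : All (λ (e , n) → n ≤ 4 × e + n ≤ 18) exceptions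
  bounds = from-yes (All.all? (λ (e , n) → n ≤? 4 ×-dec e + n ≤? 18) exceptions)

Good : ℕ → ℕ → Set
Good e n = 3 ≤ n × 8 ≤ e × (e , n) ∉ exceptions

good? : ∀ e n → Dec (Good e n)
good? e n = 3 ≤? n ×-dec 8 ≤? e ×-dec ¬? ((e , n) ∈exceptions?)

-- Unfolding the proofs produced by these decision procedures is prohibitively slow, hence abstract.
abstract
  rigid-small : All (λ e → Rigid e e) (upTo 8)
  rigid-small = from-yes (All.all? (λ e → rigid? e e) (upTo 8))

  rigid-exceptions : All (uncurry Rigid) exceptions
  rigid-exceptions = from-yes (All.all? (λ ek → rigid? (proj₁ ek) (proj₂ ek)) exceptions)

admissibleSize⇒good : AdmissibleSize (n + e) n → Good e n
admissibleSize⇒good {n} {e} (0<n , _ , _ , adm) = admissible⇒3≤ 0<n adm , 8≤e , e,n∉exc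
  where
  8≤e : 8 ≤ e
  8≤e = ≮⇒≥ (λ e<8 → rigid⇒¬admissible (All.lookup rigid-small (∈-upTo⁺ e<8)) (m⊓n≤n n e) adm)
  e,n∉exc : (e , n) ∉ exceptions
  e,n∉exc exc = rigid⇒¬admissible (All.lookup rigid-exceptions exc) (m⊓n≤m n e) adm

admissible⇒length≤sum : Admissible s p n → n ≤ s
admissible⇒length≤sum (X , _ , (pos , refl , _ , refl) , _) = length≤sum pos

¬↭-of-∉ : Any (_∉ Y) X → ¬ (X ↭ Y)
¬↭-of-∉ x∉Y X↭Y with x , x∈X , x∉Y ← find x∉Y = x∉Y (∈-resp-↭ X↭Y x∈X)

hasT-∷1 : HasT X s p n → HasT (1 ∷ X) (suc s) p (suc n)
hasT-∷1 {X} (pos , refl , refl , refl) = s≤s z≤n ∷ pos , refl , +-identityʳ (product X) , refl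

admissible-∷1 : Admissible s p n → Admissible (suc s) p (suc n)
admissible-∷1 (X , Y , hX , hY , X≁Y) = 1 ∷ X , 1 ∷ Y , hasT-∷1 hX , hasT-∷1 hY , X≁Y ∘ drop-∷

admissible-pad : ∀ k → Admissible s p n → Admissible (k + s) p (k + n)
admissible-pad zero    adm = adm
admissible-pad (suc k) adm = admissible-∷1 (admissible-pad k adm)

Collision : List ℕ → List ℕ → Set
Collision X Y =
  Positive X × Positive Y × sum X ≡ sum Y × product X ≡ product Y × length X ≡ length Y × Any (_∉ Y) X

collision? : ∀ X Y → Dec (Collision X Y)
collision? X Y =
  All.all? (0 <?_) X ×-dec All.all? (0 <?_) Y ×-dec sum X ≟ sum Y ×-dec product X ≟ product Y
    ×-dec length X ≟ length Y ×-dec Any.any? (λ x → ¬? (x ∈ℕ? Y)) X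
  where open DecMembership _≟_ renaming (_∈?_ to _∈ℕ?_)

collision⇒admissible : Collision X Y → Admissible (sum X) (product X) (length X)
collision⇒admissible {X} {Y} (posX , posY , sX≡sY , pX≡pY , lX≡lY , x∉Y) =
  X , Y , (posX , refl , refl , refl) , (posY , sym sX≡sY , sym pX≡pY , sym lX≡lY) , ¬↭-of-∉ x∉Y

IsWitness : ℕ → ℕ → List ℕ × List ℕ → Set
IsWitness e n (X , Y) = sum X ≡ length X + e × length X ≤ n × Collision X Y

isWitness? : ∀ e n W → Dec (IsWitness e n W)
isWitness? e n (X , Y) = sum X ≟ length X + e ×-dec length X ≤? n ×-dec collision? X Y

isWitness-mono : ∀ W → k ≤ n → IsWitness e k W → IsWitness e n W
isWitness-mono _ k≤n (eq , l≤k , c) = eq , ≤-trans l≤k k≤n , c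

witness⇒admissibleSize : ∀ W → 0 < n → IsWitness e n W → AdmissibleSize (n + e) n
witness⇒admissibleSize {n} {e} (X , Y) 0<n (sX≡m+e , m≤n , c@(posX , _)) =
  0<n , product X , product-positive posX , subst₂ (λ s n → Admissible s (product X) n) sum≡ length≡ padded
  where
  m : ℕ
  m = length X
  padded : Admissible (n ∸ m + sum X) (product X) (n ∸ m + m)
  padded = admissible-pad (n ∸ m) (collision⇒admissible c)
  length≡ : n ∸ m + m ≡ n
  length≡ = m∸n+n≡m m≤n
  sum≡ : n ∸ m + sum X ≡ n + e
  sum≡ = begin
    n ∸ m + sum X     ≡⟨ cong (n ∸ m +_) sX≡m+e ⟩
    n ∸ m + (m + e)   ≡⟨ sym (+-assoc (n ∸ m) m e) ⟩
    n ∸ m + m + e     ≡⟨ cong (_+ e) length≡ ⟩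
    n + e             ∎
    where open ≡-Reasoning

-- With a = 3(k+1): both triples have sum 13(k+1) + 4 + 4j and product 12(k+1)(2k+3+j)(3k+4+j),
-- and every entry of the second exceeds a.
family : ℕ → ℕ → List ℕ × List ℕ
family k j = (a ∷ 6 + k * 4 + j * 2 ∷ 8 + k * 6 + j * 2 ∷ []) , (a + suc k ∷ a + suc j ∷ a + (6 + k * 3 + j * 3) ∷ [])
  where a = 3 + k * 3

family-isWitness : ∀ k j → IsWitness (j * 4 + (k * 13 + 14)) 3 (family k j)
family-isWitness k j =
  excess k j , ≤-refl ,
  ( (s≤s z≤n ∷ s≤s z≤n ∷ s≤s z≤n ∷ []) , (s≤s z≤n ∷ s≤s z≤n ∷ s≤s z≤n ∷ [])
  , sums k j , products k j , refl , here (All¬⇒¬Any (All.map <⇒≢ above)) )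
  where
  a = 3 + k * 3
  above : All (a <_) (a + suc k ∷ a + suc j ∷ a + (6 + k * 3 + j * 3) ∷ [])
  above = m<m+n a (s≤s z≤n) ∷ m<m+n a (s≤s z≤n) ∷ m<m+n a (s≤s z≤n) ∷ []
  sums : ∀ k j → let a = 3 + k * 3 in
    a + (6 + k * 4 + j * 2 + (8 + k * 6 + j * 2 + 0)) ≡ a + suc k + (a + suc j + (a + (6 + k * 3 + j * 3) + 0))
  sums = solve-∀
  products : ∀ k j → let a = 3 + k * 3 in
    a * ((6 + k * 4 + j * 2) * ((8 + k * 6 + j * 2) * 1)) ≡ (a + suc k) * ((a + suc j) * ((a + (6 + k * 3 + j * 3)) * 1))
  products = solve-∀
  excess : ∀ k j → let a = 3 + k * 3 in
    a + (6 + k * 4 + j * 2 + (8 + k * 6 + j * 2 + 0)) ≡ 3 + (j * 4 + (k * 13 + 14))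
  excess = solve-∀

family-index : ∀ u → ∃ λ k → ∃ λ j → 53 + u ≡ j * 4 + (k * 13 + 14)
family-index 0 = 3 , 0 , refl
family-index 1 = 0 , 10 , refl
family-index 2 = 1 , 7 , refl
family-index 3 = 2 , 4 , refl
family-index (suc (suc (suc (suc u)))) with k , j , eq ← family-index u = k , suc j , cong (4 +_) eq

-- The excesses below 53 that family misses. For e = 8, 12, 15 four parts and for e = 9 five parts
-- are needed; the smaller sizes are the exceptions.
sporadic : List (List ℕ × List ℕ)
sporadic =
  (6 ∷ 2 ∷ 2 ∷ 2 ∷ [] , 4 ∷ 4 ∷ 3 ∷ 1 ∷ []) ∷
  (6 ∷ 2 ∷ 2 ∷ 2 ∷ 2 ∷ [] , 4 ∷ 4 ∷ 3 ∷ 2 ∷ 1 ∷ []) ∷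
  (9 ∷ 2 ∷ 2 ∷ [] , 6 ∷ 6 ∷ 1 ∷ []) ∷
  (10 ∷ 2 ∷ 2 ∷ [] , 8 ∷ 5 ∷ 1 ∷ []) ∷
  (10 ∷ 2 ∷ 2 ∷ 2 ∷ [] , 8 ∷ 5 ∷ 2 ∷ 1 ∷ []) ∷
  (10 ∷ 3 ∷ 3 ∷ [] , 9 ∷ 5 ∷ 2 ∷ []) ∷
  (10 ∷ 5 ∷ 2 ∷ 2 ∷ [] , 8 ∷ 5 ∷ 5 ∷ 1 ∷ []) ∷
  (12 ∷ 4 ∷ 3 ∷ [] , 9 ∷ 8 ∷ 2 ∷ []) ∷
  (15 ∷ 3 ∷ 2 ∷ [] , 10 ∷ 9 ∷ 1 ∷ []) ∷
  (10 ∷ 6 ∷ 6 ∷ [] , 9 ∷ 8 ∷ 5 ∷ []) ∷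
  (12 ∷ 6 ∷ 5 ∷ [] , 10 ∷ 9 ∷ 4 ∷ []) ∷
  (16 ∷ 5 ∷ 3 ∷ [] , 12 ∷ 10 ∷ 2 ∷ []) ∷
  (21 ∷ 3 ∷ 2 ∷ [] , 18 ∷ 7 ∷ 1 ∷ []) ∷
  (21 ∷ 4 ∷ 2 ∷ [] , 14 ∷ 12 ∷ 1 ∷ []) ∷
  (22 ∷ 4 ∷ 2 ∷ [] , 16 ∷ 11 ∷ 1 ∷ []) ∷
  (25 ∷ 4 ∷ 2 ∷ [] , 20 ∷ 10 ∷ 1 ∷ []) ∷
  (26 ∷ 3 ∷ 3 ∷ [] , 18 ∷ 13 ∷ 1 ∷ []) ∷
  (28 ∷ 5 ∷ 2 ∷ [] , 20 ∷ 14 ∷ 1 ∷ []) ∷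
  (26 ∷ 7 ∷ 3 ∷ [] , 21 ∷ 13 ∷ 2 ∷ []) ∷
  (33 ∷ 3 ∷ 3 ∷ [] , 27 ∷ 11 ∷ 1 ∷ []) ∷
  (32 ∷ 5 ∷ 3 ∷ [] , 30 ∷ 8 ∷ 2 ∷ []) ∷
  (36 ∷ 6 ∷ 2 ∷ [] , 27 ∷ 16 ∷ 1 ∷ []) ∷
  (40 ∷ 6 ∷ 2 ∷ [] , 32 ∷ 15 ∷ 1 ∷ []) ∷
  (45 ∷ 4 ∷ 3 ∷ [] , 36 ∷ 15 ∷ 1 ∷ []) ∷
  []

witnessTable : List (List ℕ × List ℕ)
witnessTable = sporadic ++ concatMap (λ k → map (family k) (upTo 10)) (upTo 4)

Covered : ℕ → ℕ → Set
Covered e n = (e , n) ∈ exceptions ⊎ Any (IsWitness e n) witnessTable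

covered? : ∀ e n → Dec (Covered e n)
covered? e n = (e , n) ∈exceptions? ⊎-dec Any.any? (isWitness? e n) witnessTable

abstract
  small-covered : All (λ e → All (Covered e) (3 ∷ 4 ∷ 5 ∷ [])) (applyUpTo (8 +_) 45)
  small-covered = from-yes (All.all? (λ e → All.all? (covered? e) (3 ∷ 4 ∷ 5 ∷ [])) (applyUpTo (8 +_) 45))

covered⇒witness : (e , n) ∉ exceptions → Covered e n → ∃ (IsWitness e n)
covered⇒witness e,n∉exc (inj₁ exc) = ⊥-elim (e,n∉exc exc)
covered⇒witness _       (inj₂ w)   = let W , _ , isW = find w in W , isW

table-witness : 8 ≤ e → e < 53 → n ∈ 3 ∷ 4 ∷ 5 ∷ [] → (e , n) ∉ exceptions → ∃ (IsWitness e n)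
table-witness 8≤e e<53 n∈ e,n∉exc =
  covered⇒witness e,n∉exc (All.lookup (All.lookup small-covered (Equivalence.from (∈-applyUpTo-+⇔ 8 45) (8≤e , e<53))) n∈)

small-witness : e < 53 → Good e n → ∃ (IsWitness e n)
small-witness {n = 0} _ (() , _)
small-witness {n = 1} _ (s≤s () , _)
small-witness {n = 2} _ (s≤s (s≤s ()) , _)
small-witness {n = 3} e<53 (_ , 8≤e , e,3∉exc) = table-witness 8≤e e<53 (here refl) e,3∉exc
small-witness {n = 4} e<53 (_ , 8≤e , e,4∉exc) = table-witness 8≤e e<53 (there (here refl)) e,4∉exc
small-witness {n = suc (suc (suc (suc (suc m))))} e<53 (_ , 8≤e , _) =
  let W , isW = table-witness 8≤e e<53 (there (there (here refl))) (λ exc → 1+n≰n (proj₁ (exception-bounds exc)))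
  in W , isWitness-mono W (s≤s (s≤s (s≤s (s≤s (s≤s z≤n))))) isW

large-witness : 53 ≤ e → 3 ≤ n → ∃ (IsWitness e n)
large-witness {e} 53≤e 3≤n with k , j , eq ← family-index (e ∸ 53) =
  family k j , isWitness-mono (family k j) 3≤n (subst (λ e → IsWitness e 3 (family k j)) e≡ (family-isWitness k j))
  where
  e≡ : j * 4 + (k * 13 + 14) ≡ e
  e≡ = trans (sym eq) (m+[n∸m]≡n 53≤e)

witness : Good e n → ∃ (IsWitness e n)
witness {e} good@(3≤n , _) with e <? 53
... | yes e<53 = small-witness e<53 good
... | no e≮53  = large-witness (≮⇒≥ e≮53) 3≤n

good⇒admissibleSize : Good e n → AdmissibleSize (n + e) n
good⇒admissibleSize good@(3≤n , _) with W , isW ← witness good = witness⇒admissibleSize W (<-≤-trans z<s 3≤n) isW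

admissibleSize⇔good : AdmissibleSize (n + e) n ⇔ Good e n
admissibleSize⇔good = mk⇔ admissibleSize⇒good good⇒admissibleSize

SizeCriterion : ℕ → ℕ → Set
SizeCriterion s n = n ≤ s × Good (s ∸ n) n

sizeCriterion? : ∀ s n → Dec (SizeCriterion s n)
sizeCriterion? s n = n ≤? s ×-dec good? (s ∸ n) n

admissibleSize⇔sizeCriterion : AdmissibleSize s n ⇔ SizeCriterion s n
admissibleSize⇔sizeCriterion {s} {n} = mk⇔ to from
  where
  to : AdmissibleSize s n → SizeCriterion s n
  to adm@(_ , _ , _ , a) = n≤s , Equivalence.to admissibleSize⇔good (subst (λ s → AdmissibleSize s n) (sym (m+[n∸m]≡n n≤s)) adm)
    where
    n≤s : n ≤ s
    n≤s = admissible⇒length≤sum a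
  from : SizeCriterion s n → AdmissibleSize s n
  from (n≤s , good) = subst (λ s → AdmissibleSize s n) (m+[n∸m]≡n n≤s) (Equivalence.from admissibleSize⇔good good)

hasCount-cong : ∀ {P Q : ℕ → Set} → (∀ {n} → P n ⇔ Q n) → HasCount P k → HasCount Q k
hasCount-cong P⇔Q (L , unique , ∈L⇔P , length≡) = L , unique , (λ n → P⇔Q ⇔-∘ ∈L⇔P n) , length≡

hasCount-filter : ∀ {P : ℕ → Set} (P? : Decidable P) {b} → (∀ {n} → P n → n < b) → HasCount P (length (filter P? (upTo b)))
hasCount-filter P? {b} bounded =
  filter P? (upTo b) , filter⁺ P? (upTo⁺ b) ,
  (λ n → mk⇔ (proj₂ ∘ ∈-filter⁻ P? {xs = upTo b}) (λ Pn → ∈-filter⁺ P? (∈-upTo⁺ (bounded Pn)) Pn)) , refl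

f-by-filter : ∀ s → fIs s (length (filter (sizeCriterion? s) (upTo (suc s))))
f-by-filter s = hasCount-cong (⇔-sym admissibleSize⇔sizeCriterion) (hasCount-filter (sizeCriterion? s) (s≤s ∘ proj₁))

hasCount-interval : ∀ a l → HasCount (λ n → a ≤ n × n < a + l) l
hasCount-interval a l =
  applyUpTo (a +_) l , applyUpTo⁺₁ (a +_) l (λ i<j _ → <⇒≢ (+-monoʳ-< a i<j)) ,
  (λ n → ∈-applyUpTo-+⇔ a l) , List.length-applyUpTo (a +_) l

sizeCriterion-large : ∀ u → SizeCriterion (19 + u) n ⇔ (3 ≤ n × n < 3 + (9 + u))
sizeCriterion-large {n} u = mk⇔ to from
  where
  to : SizeCriterion (19 + u) n → 3 ≤ n × n < 3 + (9 + u)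
  to (n≤s , 3≤n , 8≤e , _) = 3≤n , s≤s (+-cancelˡ-≤ 8 n (11 + u) (m≤o∸n⇒m+n≤o 8 n≤s 8≤e))
  from : 3 ≤ n × n < 3 + (9 + u) → SizeCriterion (19 + u) n
  from (3≤n , s≤s n≤11+u) = n≤s , 3≤n , m+n≤o⇒m≤o∸n 8 (+-monoʳ-≤ 8 n≤11+u) , e,n∉exc
    where
    n≤s : n ≤ 19 + u
    n≤s = ≤-trans n≤11+u (m≤n+m (11 + u) 8)
    e,n∉exc : (19 + u ∸ n , n) ∉ exceptions
    e,n∉exc exc = 1+n≰n (m+n≤o⇒m≤o 19 (subst (_≤ 18) (m∸n+n≡m n≤s) (proj₂ (exception-bounds exc))))

f-large : ∀ u → fIs (19 + u) (9 + u)
f-large u = hasCount-cong (⇔-sym admissibleSize⇔sizeCriterion ⇔-∘ ⇔-sym (sizeCriterion-large u)) (hasCount-interval 3 (9 + u))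

f-small : ∀ s → s < 12 → fIs s 0
f-small s s<12 = subst (fIs s) (All.lookup no-sizes (∈-upTo⁺ s<12)) (f-by-filter s)
  where
  no-sizes : All (λ s → length (filter (sizeCriterion? s) (upTo (suc s))) ≡ 0) (upTo 12)
  no-sizes = from-yes (All.all? (λ s → length (filter (sizeCriterion? s) (upTo (suc s))) ≟ 0) (upTo 12))

theorem2p1 : ((s : ℕ) → 1 ≤ s → s ≤ 11 → fIs s 0)
    × ((s : ℕ) → 19 ≤ s → fIs s (s ∸ 10))
    × fIs 12 1 × fIs 13 2 × fIs 14 4 × fIs 15 4 × fIs 16 6 × fIs 17 7 × fIs 18 7
theorem2p1 =
  (λ s _ s≤11 → f-small s (s≤s s≤11)) ,
  (λ s 19≤s → subst (λ s → fIs s (s ∸ 10)) (m+[n∸m]≡n 19≤s) (f-large (s ∸ 19))) ,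
  f-by-filter 12 , f-by-filter 13 , f-by-filter 14 , f-by-filter 15 , f-by-filter 16 , f-by-filter 17 , f-by-filter 18
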